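{- Let $d,\ell \geq 2$ be integers, let $G$ be an $\{S_d, K_{\ell,\ell}\}$-free graph, and let $I$ be a maximum independent set in $G$. Then $\alpha(G[N[v]]) < d^2 \ell + 2d\ell^{d-1}$ for every $v \in I$. Furthermore, if $d=2$, then $\alpha(G[N[v]]) < 2\ell$ for every $v\in I$.
   Context: Graphs are finite and simple. For $d\ge2$, $S_d$ is the graph obtained from the star $K_{1,d}$ by subdividing each edge exactly once ($S_2=P_5$). $K_{\ell,\ell}$ is the complete bipartite graph with parts of size $\ell$. $\mathcal{F}$-free means having no induced subgraph isomorphic to a member of $\mathcal{F}$. $N[v]$ is the closed neighborhood of $v$ and $\alpha$ the independence number; a maximum independent set is one of size $\alpha(G)$. -}

module Defs where

open import Data.Nat using (ℕ; suc; _≤_; _<_)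
open import Data.Bool using (Bool; true; false; _∧_; not)
open import Data.Fin using (Fin; _≟_)
open import Relation.Nullary using (¬_; does)
open import Data.Fin.Subset using (Subset; _∈_; ∣_∣)
open import Data.Sum using (_⊎_; inj₁; inj₂)
open import Data.Product using (Σ; _×_)
open import Relation.Binary.PropositionalEquality using (_≡_)
open import Function.Definitions using (Injective)

record Graph (n : ℕ) : Set where
  field
    adj   : Fin n → Fin n → Bool
    sym   : ∀ u v → adj u v ≡ adj v u
    irrefl : ∀ v → adj v v ≡ false
open Graph public

InducedCopy : ∀ {n} (G : Graph n) (V : Set) (Hadj : V → V → Bool) → Set
InducedCopy {n} G V Hadj =
  Σ (V → Fin n) λ f → Injective _≡_ _≡_ f × (∀ x y → adj G (f x) (f y) ≡ Hadj x y)

-- The subdivided star S_d: a centre, d middle vertices, d leaves;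
-- centre ~ mid i, and mid i ~ leaf i.
data SV (d : ℕ) : Set where
  centre : SV d
  mid    : Fin d → SV d
  leaf   : Fin d → SV d

SAdj : (d : ℕ) → SV d → SV d → Bool
SAdj d centre   (mid _)  = true
SAdj d (mid _)  centre   = true
SAdj d (mid i)  (leaf j) = does (i ≟ j)
SAdj d (leaf i) (mid j)  = does (i ≟ j)
SAdj d _        _        = false

KAdj : (l : ℕ) → (Fin l ⊎ Fin l) → (Fin l ⊎ Fin l) → Bool
KAdj l (inj₁ _) (inj₂ _) = true
KAdj l (inj₂ _) (inj₁ _) = true
KAdj l _        _        = false

SKFree : ∀ {n} (d l : ℕ) (G : Graph n) → Set
SKFree d l G = ¬ InducedCopy G (SV d) (SAdj d) × ¬ InducedCopy G (Fin l ⊎ Fin l) (KAdj l)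

Independent : ∀ {n} (G : Graph n) → Subset n → Set
Independent G S = ∀ u v → u ∈ S → v ∈ S → adj G u v ≡ false

MaximumIndependent : ∀ {n} (G : Graph n) → Subset n → Set
MaximumIndependent G I = Independent G I × (∀ J → Independent G J → ∣ J ∣ ≤ ∣ I ∣)

InClosedNbhd : ∀ {n} (G : Graph n) → Fin n → Fin n → Set
InClosedNbhd G v u = u ≡ v ⊎ adj G v u ≡ true

-- alpha(G[N[v]]) < b : every independent set of G[N[v]] (= independent set of G
-- contained in N[v]) has fewer than b vertices.
AlphaClosedNbhd< : ∀ {n} (G : Graph n) → Fin n → ℕ → Set
AlphaClosedNbhd< G v b = ∀ S → Independent G S → (∀ u → u ∈ S → InClosedNbhd G v u) → ∣ S ∣ < b

{-# OPTIONS --safe #-}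
module Submission where

-- Let J = I ─ {v} and let S ⊆ N(v) be independent. Centred at v, an induced
-- matching of size d between S and J is an induced S_d, and a complete l × l
-- bipartite pair between S and J is an induced K_{l,l}; both are excluded.
-- Since I is maximum, (J ─ N(T)) ∪ T is no larger than I for every T ⊆ S,
-- so |T| ≤ |N_J(T)| + 1. Call z ∈ S heavy if it has at least l^(d-1)
-- neighbours in J. For the light vertices T, an irredundant subcover of T
-- has private neighbours forming an induced matching, so it has fewer than d
-- vertices and |N_J(T)| ≤ (d-1)(l^(d-1) - 1). The heavy vertices are counted
-- by induction on k: without induced matchings of size k+1 and without
-- K_{l,l}, at most h_k vertices have l^k neighbours, where h_0 = 0,
-- h_1 = l - 1 and h_(k+1) = l h_k + 2(l - 1). Then h_k + 2 ≤ 2 l^k gives the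
-- general bound, and for d = 2 we get |S| ≤ (l - 1) + (l - 1) + 1 < 2l.

open import Defs renaming (sym to adj-sym)
open import Data.Nat using (ℕ; zero; suc; pred; _≤_; _<_; _+_; _*_; _^_; _∸_; _≤?_; _<?_; z≤n; s≤s)
open import Data.Nat.Properties
  using (≤-refl; ≤-trans; ≤-reflexive; ≤-<-trans; ≮⇒≥; ≰⇒>; <-irrefl; <⇒≤pred; pred[n]≤n; +-suc;
         +-identityʳ; +-mono-≤; +-monoˡ-≤; +-monoʳ-≤; +-cancelˡ-≤; +-cancelʳ-≤; m≤m+n; m≤n+m;
         *-suc; *-identityʳ; *-monoˡ-≤; *-monoʳ-≤; m^n>0; module ≤-Reasoning)
open import Data.Nat.Induction using (<-wellFounded)
open import Data.Nat.Tactic.RingSolver using (solve-∀)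
open import Data.Bool using (Bool; true; false)
open import Data.Bool.Properties using (¬-not)
open import Data.Fin using (Fin; zero; suc; _≟_)
open import Data.Fin.Properties using (any?; all?; ¬∀⟶∃¬; suc-injective)
open import Data.Fin.Subset
  using (Subset; inside; outside; _∈_; _∉_; _⊆_; _∩_; _∪_; _─_; _-_; ⊥; ⊤; ⁅_⁆; ∣_∣; Nonempty; Empty)
open import Data.Fin.Subset.Properties
  using (_∈?_; _⊆?_; nonempty?; ∈⊤; ∉⊥; x∈⁅x⁆; drop-there; ⊆-refl; p─q⊆p; p⊆q⇒∣p∣≤∣q∣; ∣⊤∣≡n; ∣⊥∣≡0;
         ∣⁅x⁆∣≡1; ∣p∩q∣≤∣q∣; Empty-unique; ∩-comm; x∈p∩q⁺; x∈p∩q⁻; x∈p∪q⁺; x∈p∪q⁻; x∈p∧x∉q⇒x∈p─q;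
         x∈p∧x≢y⇒x∈p-y; x∈p⇒∣p-x∣<∣p∣)
open import Data.Vec using ([]; _∷_; here; there; tabulate)
open import Data.Vec.Properties using ([]=⇒lookup; lookup⇒[]=; lookup∘tabulate)
open import Data.Product using (∃; _×_; _,_; proj₁; proj₂)
open import Data.Sum using (_⊎_; inj₁; inj₂; [_,_])
open import Function using (_∘_)
open import Function.Definitions using (Injective)
open import Induction.WellFounded using (Acc; acc)
open import Relation.Nullary using (¬_; yes; no; does; contradiction)
open import Relation.Nullary.Decidable using (dec-true; _×-dec_; _→-dec_)
open import Relation.Unary using (Pred; Decidable)
open import Relation.Binary.PropositionalEquality
  using (_≡_; _≢_; refl; sym; trans; cong; subst; module ≡-Reasoning)

private
  variable
    n m : ℕ

-- Counting subsets of Fin n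

∣p∪q∣+∣p∩q∣≡∣p∣+∣q∣ : (p q : Subset n) → ∣ p ∪ q ∣ + ∣ p ∩ q ∣ ≡ ∣ p ∣ + ∣ q ∣
∣p∪q∣+∣p∩q∣≡∣p∣+∣q∣ []            []            = refl
∣p∪q∣+∣p∩q∣≡∣p∣+∣q∣ (outside ∷ p) (outside ∷ q) = ∣p∪q∣+∣p∩q∣≡∣p∣+∣q∣ p q
∣p∪q∣+∣p∩q∣≡∣p∣+∣q∣ (outside ∷ p) (inside  ∷ q) =
  trans (cong suc (∣p∪q∣+∣p∩q∣≡∣p∣+∣q∣ p q)) (sym (+-suc ∣ p ∣ ∣ q ∣))
∣p∪q∣+∣p∩q∣≡∣p∣+∣q∣ (inside  ∷ p) (outside ∷ q) = cong suc (∣p∪q∣+∣p∩q∣≡∣p∣+∣q∣ p q)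
∣p∪q∣+∣p∩q∣≡∣p∣+∣q∣ (inside  ∷ p) (inside  ∷ q) = cong suc (begin
  ∣ p ∪ q ∣ + suc ∣ p ∩ q ∣   ≡⟨ +-suc ∣ p ∪ q ∣ ∣ p ∩ q ∣ ⟩
  suc (∣ p ∪ q ∣ + ∣ p ∩ q ∣) ≡⟨ cong suc (∣p∪q∣+∣p∩q∣≡∣p∣+∣q∣ p q) ⟩
  suc (∣ p ∣ + ∣ q ∣)         ≡⟨ sym (+-suc ∣ p ∣ ∣ q ∣) ⟩
  ∣ p ∣ + suc ∣ q ∣           ∎)
  where open ≡-Reasoning

∣p∪q∣≤∣p∣+∣q∣ : (p q : Subset n) → ∣ p ∪ q ∣ ≤ ∣ p ∣ + ∣ q ∣
∣p∪q∣≤∣p∣+∣q∣ p q = ≤-trans (m≤m+n ∣ p ∪ q ∣ ∣ p ∩ q ∣) (≤-reflexive (∣p∪q∣+∣p∩q∣≡∣p∣+∣q∣ p q))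

Empty⇒∣p∣≡0 : {p : Subset n} → Empty p → ∣ p ∣ ≡ 0
Empty⇒∣p∣≡0 {n} empty = trans (cong ∣_∣ (Empty-unique empty)) (∣⊥∣≡0 n)

Disjoint⇒∣p∣+∣q∣≤∣p∪q∣ : (p q : Subset n) → (∀ {x} → x ∈ p → x ∉ q) → ∣ p ∣ + ∣ q ∣ ≤ ∣ p ∪ q ∣
Disjoint⇒∣p∣+∣q∣≤∣p∪q∣ p q disjoint = begin
  ∣ p ∣ + ∣ q ∣         ≡⟨ sym (∣p∪q∣+∣p∩q∣≡∣p∣+∣q∣ p q) ⟩
  ∣ p ∪ q ∣ + ∣ p ∩ q ∣ ≡⟨ cong (∣ p ∪ q ∣ +_) (Empty⇒∣p∣≡0 p∩q-empty) ⟩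
  ∣ p ∪ q ∣ + 0         ≡⟨ +-identityʳ ∣ p ∪ q ∣ ⟩
  ∣ p ∪ q ∣             ∎
  where
  open ≤-Reasoning
  p∩q-empty : Empty (p ∩ q)
  p∩q-empty (_ , x∈p∩q) = let x∈p , x∈q = x∈p∩q⁻ p q x∈p∩q in disjoint x∈p x∈q

∣p∣≡∣p∩q∣+∣p─q∣ : (p q : Subset n) → ∣ p ∣ ≡ ∣ p ∩ q ∣ + ∣ p ─ q ∣
∣p∣≡∣p∩q∣+∣p─q∣ []            []            = refl
∣p∣≡∣p∩q∣+∣p─q∣ (outside ∷ p) (outside ∷ q) = ∣p∣≡∣p∩q∣+∣p─q∣ p q
∣p∣≡∣p∩q∣+∣p─q∣ (outside ∷ p) (inside  ∷ q) = ∣p∣≡∣p∩q∣+∣p─q∣ p q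
∣p∣≡∣p∩q∣+∣p─q∣ (inside  ∷ p) (outside ∷ q) =
  trans (cong suc (∣p∣≡∣p∩q∣+∣p─q∣ p q)) (sym (+-suc ∣ p ∩ q ∣ ∣ p ─ q ∣))
∣p∣≡∣p∩q∣+∣p─q∣ (inside  ∷ p) (inside  ∷ q) = cong suc (∣p∣≡∣p∩q∣+∣p─q∣ p q)

∣p∣≤∣q∣⇒∣p─q∣≤∣q─p∣ : (p q : Subset n) → ∣ p ∣ ≤ ∣ q ∣ → ∣ p ─ q ∣ ≤ ∣ q ─ p ∣
∣p∣≤∣q∣⇒∣p─q∣≤∣q─p∣ p q ∣p∣≤∣q∣ = +-cancelˡ-≤ ∣ p ∩ q ∣ _ _ (begin
  ∣ p ∩ q ∣ + ∣ p ─ q ∣ ≡⟨ sym (∣p∣≡∣p∩q∣+∣p─q∣ p q) ⟩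
  ∣ p ∣                 ≤⟨ ∣p∣≤∣q∣ ⟩
  ∣ q ∣                 ≡⟨ ∣p∣≡∣p∩q∣+∣p─q∣ q p ⟩
  ∣ q ∩ p ∣ + ∣ q ─ p ∣ ≡⟨ cong (λ r → ∣ r ∣ + ∣ q ─ p ∣) (∩-comm q p) ⟩
  ∣ p ∩ q ∣ + ∣ q ─ p ∣ ∎)
  where open ≤-Reasoning

x∈p─q⁻ : (p q : Subset n) {x : Fin n} → x ∈ p ─ q → x ∈ p × x ∉ q
x∈p─q⁻ (inside  ∷ p) (outside ∷ q) here        = here , λ ()
x∈p─q⁻ (inside  ∷ p) (inside  ∷ q) {zero} ()
x∈p─q⁻ (outside ∷ p) (inside  ∷ q) {zero} ()
x∈p─q⁻ (outside ∷ p) (outside ∷ q) {zero} ()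
x∈p─q⁻ (_       ∷ p) (_       ∷ q) (there x∈) =
  let x∈p , x∉q = x∈p─q⁻ p q x∈ in there x∈p , x∉q ∘ drop-there

⋃[_] : Subset m → (Fin m → Subset n) → Subset n
⋃[ [] ]            P = ⊥
⋃[ outside ∷ D ] P = ⋃[ D ] (P ∘ suc)
⋃[ inside  ∷ D ] P = P zero ∪ ⋃[ D ] (P ∘ suc)

∈⋃⁺ : {D : Subset m} {P : Fin m → Subset n} {i : Fin m} {x : Fin n} →
      i ∈ D → x ∈ P i → x ∈ ⋃[ D ] P
∈⋃⁺ {D = inside  ∷ D} here        x∈Pi = x∈p∪q⁺ (inj₁ x∈Pi)
∈⋃⁺ {D = inside  ∷ D} (there i∈D) x∈Pi = x∈p∪q⁺ (inj₂ (∈⋃⁺ {D = D} i∈D x∈Pi))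
∈⋃⁺ {D = outside ∷ D} (there i∈D) x∈Pi = ∈⋃⁺ {D = D} i∈D x∈Pi

∈⋃⁻ : (D : Subset m) (P : Fin m → Subset n) {x : Fin n} →
      x ∈ ⋃[ D ] P → ∃ λ i → i ∈ D × x ∈ P i
∈⋃⁻ []            P x∈ = contradiction x∈ ∉⊥
∈⋃⁻ (outside ∷ D) P x∈ = let i , i∈D , x∈Pi = ∈⋃⁻ D (P ∘ suc) x∈ in suc i , there i∈D , x∈Pi
∈⋃⁻ (inside  ∷ D) P x∈ with x∈p∪q⁻ (P zero) (⋃[ D ] (P ∘ suc)) x∈
... | inj₁ x∈P0 = zero , here , x∈P0
... | inj₂ x∈⋃  = let i , i∈D , x∈Pi = ∈⋃⁻ D (P ∘ suc) x∈⋃ in suc i , there i∈D , x∈Pi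

∣⋃∣≤∣D∣*c : (D : Subset m) (P : Fin m → Subset n) (c : ℕ) →
            (∀ {i} → i ∈ D → ∣ P i ∣ ≤ c) → ∣ ⋃[ D ] P ∣ ≤ ∣ D ∣ * c
∣⋃∣≤∣D∣*c {n = n} []            P c _     = ≤-reflexive (∣⊥∣≡0 n)
∣⋃∣≤∣D∣*c         (outside ∷ D) P c bound = ∣⋃∣≤∣D∣*c D (P ∘ suc) c (bound ∘ there)
∣⋃∣≤∣D∣*c         (inside  ∷ D) P c bound =
  ≤-trans (∣p∪q∣≤∣p∣+∣q∣ (P zero) (⋃[ D ] (P ∘ suc)))
          (+-mono-≤ (bound here) (∣⋃∣≤∣D∣*c D (P ∘ suc) c (bound ∘ there)))

∣⋃[⊤]∣≤m*c : (P : Fin m → Subset n) (c : ℕ) → (∀ i → ∣ P i ∣ ≤ c) → ∣ ⋃[ ⊤ ] P ∣ ≤ m * c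
∣⋃[⊤]∣≤m*c {m} P c bound =
  subst (λ s → ∣ ⋃[ ⊤ ] P ∣ ≤ s * c) (∣⊤∣≡n m) (∣⋃∣≤∣D∣*c ⊤ P c λ {i} _ → bound i)

record Members (k : ℕ) (p : Subset n) : Set where
  field
    elem           : Fin k → Fin n
    elem-injective : Injective _≡_ _≡_ elem
    elem∈          : ∀ i → elem i ∈ p
open Members public

members : ∀ {k} (p : Subset n) → k ≤ ∣ p ∣ → Members k p
members {k = zero}  p             _           =
  record { elem = λ () ; elem-injective = λ {} ; elem∈ = λ () }
members {k = suc k} (inside ∷ p)  (s≤s k≤∣p∣) = record
  { elem           = λ { zero → zero ; (suc i) → suc (elem rest i) }
  ; elem-injective = λ { {zero}  {zero}  _  → refl
                       ; {suc i} {suc j} eq → cong suc (elem-injective rest (suc-injective eq)) }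
  ; elem∈          = λ { zero → here ; (suc i) → there (elem∈ rest i) }
  }
  where
  rest : Members k p
  rest = members p k≤∣p∣
members {k = suc k} (outside ∷ p) k<∣p∣       = record
  { elem           = suc ∘ elem rest
  ; elem-injective = elem-injective rest ∘ suc-injective
  ; elem∈          = there ∘ elem∈ rest
  }
  where
  rest : Members (suc k) p
  rest = members p k<∣p∣

Members-mono : ∀ {k} {p q : Subset n} → p ⊆ q → Members k p → Members k q
Members-mono p⊆q f = record { elem = elem f ; elem-injective = elem-injective f ; elem∈ = p⊆q ∘ elem∈ f }

¬Members⇒∣p∣≤ : ∀ {b} (p : Subset n) → ¬ Members (suc b) p → ∣ p ∣ ≤ b
¬Members⇒∣p∣≤ p none = ≮⇒≥ (none ∘ members p)

∣p∣>0⇒Nonempty : (p : Subset n) → 0 < ∣ p ∣ → Nonempty p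
∣p∣>0⇒Nonempty p 0<∣p∣ = elem f zero , elem∈ f zero
  where
  f : Members 1 p
  f = members p 0<∣p∣

Nonempty⇒∣p∣>0 : (p : Subset n) → Nonempty p → 0 < ∣ p ∣
Nonempty⇒∣p∣>0 (inside  ∷ p) _                   = s≤s z≤n
Nonempty⇒∣p∣>0 (outside ∷ p) (suc x , there x∈p) = Nonempty⇒∣p∣>0 p (x , x∈p)

⊈⇒∃ : {p q : Subset n} → ¬ p ⊆ q → ∃ λ x → x ∈ p × x ∉ q
⊈⇒∃ {n} {p} {q} p⊈q with ¬∀⟶∃¬ n (λ x → x ∈ p → x ∈ q) (λ x → x ∈? p →-dec x ∈? q) (λ ∀x → p⊈q (∀x _))
... | x , ¬[x∈p⇒x∈q] with x ∈? p
...   | yes x∈p = x , x∈p , λ x∈q → ¬[x∈p⇒x∈q] (λ _ → x∈q)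
...   | no  x∉p = contradiction (λ x∈p → contradiction x∈p x∉p) ¬[x∈p⇒x∈q]

argmin : (φ : Fin n → ℕ) {p : Subset n} → Nonempty p → ∃ λ x → x ∈ p × (∀ {z} → z ∈ p → φ x ≤ φ z)
argmin φ {p} (x , x∈p) = descend x x∈p (<-wellFounded (φ x))
  where
  descend : ∀ x → x ∈ p → Acc _<_ (φ x) → ∃ λ x → x ∈ p × (∀ {z} → z ∈ p → φ x ≤ φ z)
  descend x x∈p (acc smaller) with any? (λ z → z ∈? p ×-dec φ z <? φ x)
  ... | yes (z , z∈p , φz<φx) = descend z z∈p (smaller φz<φx)
  ... | no  none              = x , x∈p , λ z∈p → ≮⇒≥ λ φz<φx → none (_ , z∈p , φz<φx)

∈-tabulate⁺ : {f : Fin n → Bool} {x : Fin n} → f x ≡ true → x ∈ tabulate f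
∈-tabulate⁺ {f = f} {x} fx = lookup⇒[]= x (tabulate f) (trans (lookup∘tabulate f x) fx)

∈-tabulate⁻ : {f : Fin n → Bool} {x : Fin n} → x ∈ tabulate f → f x ≡ true
∈-tabulate⁻ {f = f} {x} x∈ = trans (sym (lookup∘tabulate f x)) ([]=⇒lookup x∈)

select : ∀ {ℓ} {P : Pred (Fin n) ℓ} → Decidable P → Subset n
select P? = tabulate (does ∘ P?)

∈select⁺ : ∀ {ℓ} {P : Pred (Fin n) ℓ} (P? : Decidable P) {x : Fin n} → P x → x ∈ select P?
∈select⁺ P? {x} Px = ∈-tabulate⁺ (dec-true (P? x) Px)

∈select⁻ : ∀ {ℓ} {P : Pred (Fin n) ℓ} (P? : Decidable P) {x : Fin n} → x ∈ select P? → P x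
∈select⁻ P? {x} x∈ with P? x | ∈-tabulate⁻ {f = does ∘ P?} x∈
... | yes Px | _ = Px

-- Neighbourhoods, induced matchings and bicliques

module _ {n : ℕ} (G : Graph n) where

  N : Fin n → Subset n
  N x = tabulate (adj G x)

  Nˢ : Subset n → Subset n
  Nˢ D = ⋃[ D ] N

  deg : Subset n → Fin n → ℕ
  deg B x = ∣ B ∩ N x ∣

  N-sym : ∀ {x y} → y ∈ N x → x ∈ N y
  N-sym {x} {y} y∈Nx = ∈-tabulate⁺ (trans (adj-sym G y x) (∈-tabulate⁻ y∈Nx))

  ∉N⇒adj≡false : ∀ {x y} → y ∉ N x → adj G x y ≡ false
  ∉N⇒adj≡false y∉Nx = ¬-not (y∉Nx ∘ ∈-tabulate⁺)

  adj≡false⇒∉N : ∀ {x y} → adj G x y ≡ false → y ∉ N x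
  adj≡false⇒∉N x≁y y∈Nx with () ← trans (sym (∈-tabulate⁻ y∈Nx)) x≁y

  N-irrefl : ∀ {x} → x ∉ N x
  N-irrefl {x} = adj≡false⇒∉N (irrefl G x)

  Independent⇒∉N : ∀ {p x y} → Independent G p → x ∈ p → y ∈ p → y ∉ N x
  Independent⇒∉N indep x∈p y∈p = adj≡false⇒∉N (indep _ _ x∈p y∈p)

  Independent-⊆ : ∀ {p q} → p ⊆ q → Independent G q → Independent G p
  Independent-⊆ p⊆q indep x y x∈p y∈p = indep x y (p⊆q x∈p) (p⊆q y∈p)

  Independent-∪ : ∀ {p q} → Independent G p → Independent G q →
                  (∀ {x y} → x ∈ p → y ∈ q → y ∉ N x) → Independent G (p ∪ q)
  Independent-∪ {p} {q} indp indq across x y x∈ y∈ with x∈p∪q⁻ p q x∈ | x∈p∪q⁻ p q y∈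
  ... | inj₁ x∈p | inj₁ y∈p = indp x y x∈p y∈p
  ... | inj₂ x∈q | inj₂ y∈q = indq x y x∈q y∈q
  ... | inj₁ x∈p | inj₂ y∈q = ∉N⇒adj≡false (across x∈p y∈q)
  ... | inj₂ x∈q | inj₁ y∈p = ∉N⇒adj≡false (across y∈p x∈q ∘ N-sym)

  record InducedMatching (k : ℕ) (A B : Subset n) : Set where
    field
      left right : Fin k → Fin n
      left∈      : ∀ i → left i ∈ A
      right∈     : ∀ i → right i ∈ B
      matched    : ∀ i → right i ∈ N (left i)
      unmatched  : ∀ {i j} → i ≢ j → right j ∉ N (left i)
  open InducedMatching public

  left-injective : ∀ {k A B} (M : InducedMatching k A B) → Injective _≡_ _≡_ (left M)
  left-injective M {i} {j} left-i≡left-j with i ≟ j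
  ... | yes i≡j = i≡j
  ... | no  i≢j = contradiction (subst (λ x → right M j ∈ N x) (sym left-i≡left-j) (matched M j))
                                (unmatched M i≢j)

  right-injective : ∀ {k A B} (M : InducedMatching k A B) → Injective _≡_ _≡_ (right M)
  right-injective M {i} {j} right-i≡right-j with i ≟ j
  ... | yes i≡j = i≡j
  ... | no  i≢j = contradiction (subst (_∈ N (left M i)) right-i≡right-j (matched M i)) (unmatched M i≢j)

  InducedMatching-monoˡ : ∀ {k A A′ B} → A ⊆ A′ → InducedMatching k A B → InducedMatching k A′ B
  InducedMatching-monoˡ A⊆A′ M = record
    { left = left M ; right = right M ; left∈ = A⊆A′ ∘ left∈ M ; right∈ = right∈ M
    ; matched = matched M ; unmatched = unmatched M }

  InducedMatching-zero : ∀ {A B} → InducedMatching 0 A B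
  InducedMatching-zero = record
    { left = λ () ; right = λ () ; left∈ = λ () ; right∈ = λ () ; matched = λ () ; unmatched = λ {} }

  InducedMatching-extend : ∀ {k A B x y} → x ∈ A → y ∈ B → y ∈ N x →
                           InducedMatching k (A ─ N y) (B ─ N x) → InducedMatching (suc k) A B
  InducedMatching-extend {k} {A} {B} {x} {y} x∈A y∈B y∈Nx M = record
    { left = left′ ; right = right′ ; left∈ = left′∈ ; right∈ = right′∈
    ; matched = matched′ ; unmatched = unmatched′ }
    where
    left′ right′ : Fin (suc k) → Fin n
    left′ zero     = x
    left′ (suc i)  = left M i
    right′ zero    = y
    right′ (suc i) = right M i

    left′∈ : ∀ i → left′ i ∈ A
    left′∈ zero    = x∈A
    left′∈ (suc i) = proj₁ (x∈p─q⁻ A (N y) (left∈ M i))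

    right′∈ : ∀ i → right′ i ∈ B
    right′∈ zero    = y∈B
    right′∈ (suc i) = proj₁ (x∈p─q⁻ B (N x) (right∈ M i))

    matched′ : ∀ i → right′ i ∈ N (left′ i)
    matched′ zero    = y∈Nx
    matched′ (suc i) = matched M i

    unmatched′ : ∀ {i j} → i ≢ j → right′ j ∉ N (left′ i)
    unmatched′ {zero}  {zero}  i≢j = contradiction refl i≢j
    unmatched′ {zero}  {suc j} _   = proj₂ (x∈p─q⁻ B (N x) (right∈ M j))
    unmatched′ {suc i} {zero}  _   = proj₂ (x∈p─q⁻ A (N y) (left∈ M i)) ∘ N-sym
    unmatched′ {suc i} {suc j} i≢j = unmatched M (i≢j ∘ cong suc)

  edgeless : ∀ {A B z w} → ¬ InducedMatching 1 A B → z ∈ A → w ∈ B → w ∉ N z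
  edgeless noMatching z∈A w∈B w∈Nz =
    noMatching (InducedMatching-extend z∈A w∈B w∈Nz InducedMatching-zero)

  BicliqueFree : ℕ → Subset n → Subset n → Set
  BicliqueFree l A B = (f : Members l A) (g : Members l B) → ¬ (∀ i j → elem g j ∈ N (elem f i))

  BicliqueFree-mono : ∀ {l A A′ B B′} → A′ ⊆ A → B′ ⊆ B → BicliqueFree l A B → BicliqueFree l A′ B′
  BicliqueFree-mono A′⊆A B′⊆B free f g = free (Members-mono A′⊆A f) (Members-mono B′⊆B g)

  BicliqueFree-sym : ∀ {l A B} → BicliqueFree l A B → BicliqueFree l B A
  BicliqueFree-sym free f g complete = free g f λ i j → N-sym (complete j i)

  ¬K⇒BicliqueFree : ∀ {l A B} → ¬ InducedCopy G (Fin l ⊎ Fin l) (KAdj l) →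
                    Independent G A → Independent G B → BicliqueFree l A B
  ¬K⇒BicliqueFree {l} noK indA indB f g complete = noK (embedding , injective , adjacency)
    where
    embedding : Fin l ⊎ Fin l → Fin n
    embedding = [ elem f , elem g ]

    across : ∀ i j → elem f i ≢ elem g j
    across i j fi≡gj = N-irrefl (subst (λ x → elem g j ∈ N x) fi≡gj (complete i j))

    injective : Injective _≡_ _≡_ embedding
    injective {inj₁ i} {inj₁ j} eq = cong inj₁ (elem-injective f eq)
    injective {inj₂ i} {inj₂ j} eq = cong inj₂ (elem-injective g eq)
    injective {inj₁ i} {inj₂ j} eq = contradiction eq (across i j)
    injective {inj₂ i} {inj₁ j} eq = contradiction (sym eq) (across j i)

    adjacency : ∀ a b → adj G (embedding a) (embedding b) ≡ KAdj l a b
    adjacency (inj₁ i) (inj₁ j) = indA _ _ (elem∈ f i) (elem∈ f j)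
    adjacency (inj₁ i) (inj₂ j) = ∈-tabulate⁻ (complete i j)
    adjacency (inj₂ i) (inj₁ j) = ∈-tabulate⁻ (N-sym (complete j i))
    adjacency (inj₂ i) (inj₂ j) = indB _ _ (elem∈ g i) (elem∈ g j)

  ⋂N : ∀ {k} → (Fin k → Fin n) → Subset n
  ⋂N e = select (λ x → all? (λ i → x ∈? N (e i)))

  ∈⋂N⁺ : ∀ {k} (e : Fin k → Fin n) {x} → (∀ i → x ∈ N (e i)) → x ∈ ⋂N e
  ∈⋂N⁺ e = ∈select⁺ (λ x → all? (λ i → x ∈? N (e i)))

  ∈⋂N⁻ : ∀ {k} (e : Fin k → Fin n) {x} → x ∈ ⋂N e → ∀ i → x ∈ N (e i)
  ∈⋂N⁻ e = ∈select⁻ (λ x → all? (λ i → x ∈? N (e i)))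

  ∣A∩⋂N∣≤ : ∀ {m A B} → BicliqueFree (suc m) A B → (g : Members (suc m) B) → ∣ A ∩ ⋂N (elem g) ∣ ≤ m
  ∣A∩⋂N∣≤ {A = A} free g = ¬Members⇒∣p∣≤ _ λ f →
    free (Members-mono (proj₁ ∘ x∈p∩q⁻ A _) f) g λ i j →
      N-sym (∈⋂N⁻ (elem g) (proj₂ (x∈p∩q⁻ A _ (elem∈ f i))) j)

  PrivateNeighbours : Subset n → Subset n → Set
  PrivateNeighbours B D =
    ∀ {a} → a ∈ D → ∃ λ w → w ∈ B × w ∈ N a × (∀ {b} → b ∈ D → b ≢ a → w ∉ N b)

  irredundant-subcover : (B D : Subset n) → ∃ λ C → C ⊆ D × B ∩ Nˢ D ⊆ Nˢ C × PrivateNeighbours B C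
  irredundant-subcover B D = shrink D (<-wellFounded ∣ D ∣)
    where
    Redundant : Subset n → Fin n → Set
    Redundant D a = B ∩ Nˢ D ⊆ Nˢ (D - a)

    private-neighbour : ∀ {D a} → a ∈ D → ¬ Redundant D a →
                        ∃ λ w → w ∈ B × w ∈ N a × (∀ {b} → b ∈ D → b ≢ a → w ∉ N b)
    private-neighbour {D} {a} a∈D irredundant with ⊈⇒∃ irredundant
    ... | w , w∈B∩NˢD , w∉Nˢ[D-a] with x∈p∩q⁻ B (Nˢ D) w∈B∩NˢD
    ...   | w∈B , w∈NˢD with ∈⋃⁻ D N w∈NˢD
    ...     | z , z∈D , w∈Nz with z ≟ a
    ...       | yes refl = w , w∈B , w∈Nz , λ b∈D b≢a w∈Nb →
                             w∉Nˢ[D-a] (∈⋃⁺ (x∈p∧x≢y⇒x∈p-y b∈D b≢a) w∈Nb)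
    ...       | no  z≢a  = contradiction (∈⋃⁺ (x∈p∧x≢y⇒x∈p-y z∈D z≢a) w∈Nz) w∉Nˢ[D-a]

    shrink : ∀ D → Acc _<_ ∣ D ∣ → ∃ λ C → C ⊆ D × B ∩ Nˢ D ⊆ Nˢ C × PrivateNeighbours B C
    shrink D (acc smaller) with any? (λ a → a ∈? D ×-dec B ∩ Nˢ D ⊆? Nˢ (D - a))
    ... | yes (a , a∈D , redundant) =
      let C , C⊆D-a , covers , private-nbrs = shrink (D - a) (smaller (x∈p⇒∣p-x∣<∣p∣ a∈D))
      in  C , p─q⊆p D _ ∘ C⊆D-a , (λ w∈ → covers (x∈p∩q⁺ (proj₁ (x∈p∩q⁻ B _ w∈) , redundant w∈))) ,
          private-nbrs
    ... | no none = D , ⊆-refl , proj₂ ∘ x∈p∩q⁻ B _ ,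
                    λ a∈D → private-neighbour a∈D λ redundant → none (_ , a∈D , redundant)

  -- The private neighbours of an irredundant subcover of A form an induced matching.
  ∣B∩NˢA∣≤k*c : ∀ {k c A B} → ¬ InducedMatching (suc k) A B → (∀ {z} → z ∈ A → deg B z ≤ c) →
                ∣ B ∩ Nˢ A ∣ ≤ k * c
  ∣B∩NˢA∣≤k*c {k} {c} {A} {B} noMatching deg≤c with irredundant-subcover B A
  ... | C , C⊆A , covers , private-nbrs = begin
    ∣ B ∩ Nˢ A ∣               ≤⟨ p⊆q⇒∣p∣≤∣q∣ B∩NˢA⊆⋃ ⟩
    ∣ ⋃[ C ] (λ z → B ∩ N z) ∣ ≤⟨ ∣⋃∣≤∣D∣*c C _ c (deg≤c ∘ C⊆A) ⟩
    ∣ C ∣ * c                  ≤⟨ *-monoˡ-≤ c (¬Members⇒∣p∣≤ C (noMatching ∘ matching)) ⟩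
    k * c                      ∎
    where
    open ≤-Reasoning
    B∩NˢA⊆⋃ : B ∩ Nˢ A ⊆ ⋃[ C ] (λ z → B ∩ N z)
    B∩NˢA⊆⋃ w∈ with x∈p∩q⁻ B _ w∈
    ... | w∈B , _ with ∈⋃⁻ C N (covers w∈)
    ...   | z , z∈C , w∈Nz = ∈⋃⁺ z∈C (x∈p∩q⁺ (w∈B , w∈Nz))

    matching : Members (suc k) C → InducedMatching (suc k) A B
    matching f = record
      { left      = elem f
      ; right     = proj₁ ∘ private-nbrs ∘ elem∈ f
      ; left∈     = C⊆A ∘ elem∈ f
      ; right∈    = proj₁ ∘ proj₂ ∘ private-nbrs ∘ elem∈ f
      ; matched   = proj₁ ∘ proj₂ ∘ proj₂ ∘ private-nbrs ∘ elem∈ f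
      ; unmatched = λ {i} {j} i≢j →
          proj₂ (proj₂ (proj₂ (private-nbrs (elem∈ f j)))) (elem∈ f i) (i≢j ∘ elem-injective f)
      }

  ∣B∩Nx─Nz∣≤∣B─Nx∩Nz∣ : ∀ B {x z} → deg B x ≤ deg B z → ∣ B ∩ N x ─ N z ∣ ≤ ∣ (B ─ N x) ∩ N z ∣
  ∣B∩Nx─Nz∣≤∣B─Nx∩Nz∣ B {x} {z} degx≤degz = begin
    ∣ B ∩ N x ─ N z ∣     ≤⟨ p⊆q⇒∣p∣≤∣q∣ enlarge-subtrahend ⟩
    ∣ B ∩ N x ─ B ∩ N z ∣ ≤⟨ ∣p∣≤∣q∣⇒∣p─q∣≤∣q─p∣ (B ∩ N x) (B ∩ N z) degx≤degz ⟩
    ∣ B ∩ N z ─ B ∩ N x ∣ ≤⟨ p⊆q⇒∣p∣≤∣q∣ reassociate ⟩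
    ∣ (B ─ N x) ∩ N z ∣   ∎
    where
    open ≤-Reasoning
    enlarge-subtrahend : B ∩ N x ─ N z ⊆ B ∩ N x ─ B ∩ N z
    enlarge-subtrahend w∈ with x∈p─q⁻ (B ∩ N x) (N z) w∈
    ... | w∈B∩Nx , w∉Nz = x∈p∧x∉q⇒x∈p─q w∈B∩Nx (w∉Nz ∘ proj₂ ∘ x∈p∩q⁻ B (N z))

    reassociate : B ∩ N z ─ B ∩ N x ⊆ (B ─ N x) ∩ N z
    reassociate w∈ with x∈p─q⁻ (B ∩ N z) (B ∩ N x) w∈
    ... | w∈B∩Nz , w∉B∩Nx with x∈p∩q⁻ B (N z) w∈B∩Nz
    ...   | w∈B , w∈Nz = x∈p∩q⁺ (x∈p∧x∉q⇒x∈p─q w∈B (λ w∈Nx → w∉B∩Nx (x∈p∩q⁺ (w∈B , w∈Nx))) , w∈Nz)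

  -- Opaque, so that t, A and B can be inferred from a proof of z ∈ heavy t A B.
  opaque
    heavy : ℕ → Subset n → Subset n → Subset n
    heavy t A B = A ∩ select (λ z → t ≤? deg B z)

    heavy⁺ : ∀ {t A B z} → z ∈ A → t ≤ deg B z → z ∈ heavy t A B
    heavy⁺ {t} {B = B} z∈A t≤deg = x∈p∩q⁺ (z∈A , ∈select⁺ (λ z → t ≤? deg B z) t≤deg)

    heavy⁻ : ∀ {t A B z} → z ∈ heavy t A B → z ∈ A × t ≤ deg B z
    heavy⁻ {t} {A} {B} z∈ with x∈p∩q⁻ A _ z∈
    ... | z∈A , z∈select = z∈A , ∈select⁻ (λ z → t ≤? deg B z) z∈select

-- Heavy vertices

l*P≤c+l*pred[P]⇒l≤c : ∀ l {P} c → 0 < P → l * P ≤ c + l * pred P → l ≤ c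
l*P≤c+l*pred[P]⇒l≤c l {suc p} c _ le = +-cancelʳ-≤ (l * p) l c (subst (_≤ c + l * p) (*-suc l p) le)

module _ {n : ℕ} (G : Graph n) (m : ℕ) where

  private
    l : ℕ
    l = suc m

  FewHeavy : ℕ → ℕ → Set
  FewHeavy k h = ∀ {A B} → BicliqueFree G l A B → ¬ InducedMatching G (suc k) A B →
                 ∣ heavy G (l ^ k) A B ∣ ≤ h

  -- A vertex of Out (heavy towards
  -- B ─ N x) is either adjacent to all of l chosen neighbours e of x, and there are fewer
  -- than l such, or it misses some e i and is counted by the induction hypothesis on
  -- (A ─ N (e i), B ─ N x). By minimality every vertex of H ─ Out misses fewer than l^k of
  -- the at least l^(k+1) neighbours of x, so any l of them have l common neighbours.
  module HeavyStep {k h} (ih : FewHeavy k h) {A B} (free : BicliqueFree G l A B)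
                   (noMatching : ¬ InducedMatching G (suc (suc k)) A B)
                   {x} (x∈H : x ∈ heavy G (l ^ suc k) A B)
                   (x-min : ∀ {z} → z ∈ heavy G (l ^ suc k) A B → deg G B x ≤ deg G B z) where

    H NX Out : Subset n
    H   = heavy G (l ^ suc k) A B
    NX  = B ∩ N G x
    Out = heavy G (l ^ k) A (B ─ N G x)

    x∈A : x ∈ A
    x∈A = proj₁ (heavy⁻ G x∈H)

    l*l^k≤∣NX∣ : l * l ^ k ≤ ∣ NX ∣
    l*l^k≤∣NX∣ = proj₂ (heavy⁻ G x∈H)

    NX⊆B : NX ⊆ B
    NX⊆B = proj₁ ∘ x∈p∩q⁻ B _

    e : Members l NX
    e = members NX (≤-trans (≤-reflexive (sym (*-identityʳ l)))
                            (≤-trans (*-monoʳ-≤ l (m^n>0 l k)) l*l^k≤∣NX∣))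

    Outᵢ : Fin l → Subset n
    Outᵢ i = heavy G (l ^ k) (A ─ N G (elem e i)) (B ─ N G x)

    Out⊆ : Out ⊆ A ∩ ⋂N G (elem e) ∪ ⋃[ ⊤ ] Outᵢ
    Out⊆ {z} z∈Out with heavy⁻ G z∈Out | all? (λ i → z ∈? N G (elem e i))
    ... | z∈A , _          | yes complete  = x∈p∪q⁺ (inj₁ (x∈p∩q⁺ (z∈A , ∈⋂N⁺ G (elem e) complete)))
    ... | z∈A , heavy-in-B | no incomplete with ¬∀⟶∃¬ l _ (λ i → z ∈? N G (elem e i)) incomplete
    ...   | i , z∉Nei = x∈p∪q⁺ {p = A ∩ ⋂N G (elem e)}
                          (inj₂ (∈⋃⁺ {P = Outᵢ} ∈⊤ (heavy⁺ G (x∈p∧x∉q⇒x∈p─q z∈A z∉Nei) heavy-in-B)))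

    ∣Outᵢ∣≤h : ∀ i → ∣ Outᵢ i ∣ ≤ h
    ∣Outᵢ∣≤h i with x∈p∩q⁻ B _ (elem∈ e i)
    ... | ei∈B , ei∈Nx = ih (BicliqueFree-mono G (p─q⊆p A _) (p─q⊆p B _) free)
                            (noMatching ∘ InducedMatching-extend G x∈A ei∈B ei∈Nx)

    ∣Out∣≤m+l*h : ∣ Out ∣ ≤ m + l * h
    ∣Out∣≤m+l*h = ≤-trans (p⊆q⇒∣p∣≤∣q∣ Out⊆) (≤-trans (∣p∪q∣≤∣p∣+∣q∣ (A ∩ ⋂N G (elem e)) (⋃[ ⊤ ] Outᵢ))
      (+-mono-≤ (∣A∩⋂N∣≤ G free (Members-mono NX⊆B e)) (∣⋃[⊤]∣≤m*c Outᵢ h ∣Outᵢ∣≤h)))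

    missed<l^k : ∀ {z} → z ∈ H ─ Out → ∣ NX ─ N G z ∣ < l ^ k
    missed<l^k z∈ with x∈p─q⁻ H Out z∈
    ... | z∈H , z∉Out = ≤-<-trans (∣B∩Nx─Nz∣≤∣B─Nx∩Nz∣ G B (x-min z∈H))
                                   (≰⇒> (z∉Out ∘ heavy⁺ G (proj₁ (heavy⁻ G z∈H))))

    module _ (z : Members l (H ─ Out)) where

      Missed : Fin l → Subset n
      Missed j = NX ─ N G (elem z j)

      NX⊆ : NX ⊆ NX ∩ ⋂N G (elem z) ∪ ⋃[ ⊤ ] Missed
      NX⊆ {w} w∈NX with all? (λ j → w ∈? N G (elem z j))
      ... | yes complete  = x∈p∪q⁺ (inj₁ (x∈p∩q⁺ (w∈NX , ∈⋂N⁺ G (elem z) complete)))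
      ... | no incomplete with ¬∀⟶∃¬ l _ (λ j → w ∈? N G (elem z j)) incomplete
      ...   | j , w∉Nzj =
        x∈p∪q⁺ {p = NX ∩ ⋂N G (elem z)} (inj₂ (∈⋃⁺ {P = Missed} ∈⊤ (x∈p∧x∉q⇒x∈p─q w∈NX w∉Nzj)))

      l≤∣NX∩⋂N∣ : l ≤ ∣ NX ∩ ⋂N G (elem z) ∣
      l≤∣NX∩⋂N∣ = l*P≤c+l*pred[P]⇒l≤c l _ (m^n>0 l k) (begin
        l * l ^ k                                     ≤⟨ l*l^k≤∣NX∣ ⟩
        ∣ NX ∣                                        ≤⟨ p⊆q⇒∣p∣≤∣q∣ NX⊆ ⟩
        ∣ NX ∩ ⋂N G (elem z) ∪ ⋃[ ⊤ ] Missed ∣        ≤⟨ ∣p∪q∣≤∣p∣+∣q∣ (NX ∩ ⋂N G (elem z)) _ ⟩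
        ∣ NX ∩ ⋂N G (elem z) ∣ + ∣ ⋃[ ⊤ ] Missed ∣    ≤⟨ +-monoʳ-≤ _ (∣⋃[⊤]∣≤m*c Missed _ ∣Missed∣≤) ⟩
        ∣ NX ∩ ⋂N G (elem z) ∣ + l * pred (l ^ k)     ∎)
        where
        open ≤-Reasoning
        ∣Missed∣≤ : ∀ j → ∣ Missed j ∣ ≤ pred (l ^ k)
        ∣Missed∣≤ j = <⇒≤pred (missed<l^k (elem∈ z j))

      ∣B∩⋂N∣≤m : ∣ B ∩ ⋂N G (elem z) ∣ ≤ m
      ∣B∩⋂N∣≤m = ∣A∩⋂N∣≤ G (BicliqueFree-sym G free)
                           (Members-mono (proj₁ ∘ heavy⁻ G ∘ proj₁ ∘ x∈p─q⁻ H Out) z)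

      NX∩⋂N⊆B∩⋂N : NX ∩ ⋂N G (elem z) ⊆ B ∩ ⋂N G (elem z)
      NX∩⋂N⊆B∩⋂N w∈ = let w∈NX , w∈⋂N = x∈p∩q⁻ NX _ w∈ in x∈p∩q⁺ (NX⊆B w∈NX , w∈⋂N)

    ∣H─Out∣≤m : ∣ H ─ Out ∣ ≤ m
    ∣H─Out∣≤m = ¬Members⇒∣p∣≤ (H ─ Out) λ z →
      <-irrefl refl (≤-trans (l≤∣NX∩⋂N∣ z) (≤-trans (p⊆q⇒∣p∣≤∣q∣ (NX∩⋂N⊆B∩⋂N z)) (∣B∩⋂N∣≤m z)))

  heavy-step : ∀ {k h} → FewHeavy k h → FewHeavy (suc k) (l * h + 2 * m)
  heavy-step {k} {h} ih {A} {B} free noMatching with nonempty? (heavy G (l ^ suc k) A B)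
  ... | no  empty    = ≤-trans (≤-reflexive (Empty⇒∣p∣≡0 empty)) z≤n
  ... | yes nonempty with argmin (deg G B) nonempty
  ...   | x , x∈H , x-min = begin
    ∣ H ∣                     ≡⟨ ∣p∣≡∣p∩q∣+∣p─q∣ H Out ⟩
    ∣ H ∩ Out ∣ + ∣ H ─ Out ∣ ≤⟨ +-mono-≤ (≤-trans (∣p∩q∣≤∣q∣ H Out) ∣Out∣≤m+l*h) ∣H─Out∣≤m ⟩
    m + l * h + m             ≡⟨ rearrange m (l * h) ⟩
    l * h + 2 * m             ∎
    where
    open HeavyStep ih free noMatching x∈H x-min
    open ≤-Reasoning
    rearrange : ∀ m a → m + a + m ≡ a + 2 * m
    rearrange = solve-∀

  heavy-bound₀ : FewHeavy 0 0
  heavy-bound₀ {A} {B} _ noMatching = ¬Members⇒∣p∣≤ _ λ f →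
    let z∈A , 1≤deg = heavy⁻ G (elem∈ f zero)
        w , w∈B∩Nz  = ∣p∣>0⇒Nonempty _ 1≤deg
        w∈B , w∈Nz  = x∈p∩q⁻ B _ w∈B∩Nz
    in  edgeless G noMatching z∈A w∈B w∈Nz

  -- With a minimum-degree x as in HeavyStep, no heavy z can miss a neighbour w of x:
  -- z would have a neighbour outside N x, giving the induced matching {xw, zu}.
  heavy-bound₁ : FewHeavy 1 m
  heavy-bound₁ {A} {B} free noMatching with nonempty? (heavy G (l ^ 1) A B)
  ... | no  empty    = ≤-trans (≤-reflexive (Empty⇒∣p∣≡0 empty)) z≤n
  ... | yes nonempty with argmin (deg G B) nonempty
  ...   | x , x∈H , x-min =
    ≤-trans (p⊆q⇒∣p∣≤∣q∣ H⊆) (∣A∩⋂N∣≤ G free (Members-mono (proj₁ ∘ x∈p∩q⁻ B _) g))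
    where
    H NX : Subset n
    H  = heavy G (l ^ 1) A B
    NX = B ∩ N G x

    g : Members l NX
    g = members NX (subst (_≤ ∣ NX ∣) (*-identityʳ l) (proj₂ (heavy⁻ G x∈H)))

    adjacent : ∀ {z w} → z ∈ H → w ∈ NX → z ∈ N G w
    adjacent {z} {w} z∈H w∈NX with z ∈? N G w
    ... | yes z∈Nw = z∈Nw
    ... | no  z∉Nw =
      let w∈B , w∈Nx    = x∈p∩q⁻ B _ w∈NX
          z∈A           = proj₁ (heavy⁻ G z∈H)
          0<missed      = Nonempty⇒∣p∣>0 (NX ─ N G z) (w , x∈p∧x∉q⇒x∈p─q w∈NX (z∉Nw ∘ N-sym G))
          u , u∈        = ∣p∣>0⇒Nonempty _ (≤-trans 0<missed (∣B∩Nx─Nz∣≤∣B─Nx∩Nz∣ G B (x-min z∈H)))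
          u∈B─Nx , u∈Nz = x∈p∩q⁻ (B ─ N G x) _ u∈
          x∈A           = proj₁ (heavy⁻ G x∈H)
      in  contradiction u∈Nz (edgeless G (noMatching ∘ InducedMatching-extend G x∈A w∈B w∈Nx)
                                (x∈p∧x∉q⇒x∈p─q z∈A z∉Nw) u∈B─Nx)

    H⊆ : H ⊆ A ∩ ⋂N G (elem g)
    H⊆ z∈H = x∈p∩q⁺ (proj₁ (heavy⁻ G z∈H) , ∈⋂N⁺ G (elem g) (λ i → adjacent z∈H (elem∈ g i)))

-- The recursion would give heavyBound m 1 = 2 * m; the sharper base case gives 2 l for d = 2.
heavyBound : ℕ → ℕ → ℕ
heavyBound m zero          = 0
heavyBound m (suc zero)    = m
heavyBound m (suc (suc k)) = suc m * heavyBound m (suc k) + 2 * m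

heavy-bound : ∀ {n} (G : Graph n) m k → FewHeavy G m k (heavyBound m k)
heavy-bound G m zero          = heavy-bound₀ G m
heavy-bound G m (suc zero)    = heavy-bound₁ G m
heavy-bound G m (suc (suc k)) = heavy-step G m (heavy-bound G m (suc k))

-- Independent sets in the neighbourhood of a vertex of a maximum independent set

module _ {n : ℕ} (G : Graph n) {I : Subset n} (maxI : MaximumIndependent G I)
         {v : Fin n} (v∈I : v ∈ I) where

  J : Subset n
  J = I - v

  private
    I-independent : Independent G I
    I-independent = proj₁ maxI

    J⊆I : J ⊆ I
    J⊆I = p─q⊆p I ⁅ v ⁆

    J∩Nv≡∅ : ∀ {u} → u ∈ J → u ∉ N G v
    J∩Nv≡∅ u∈J = Independent⇒∉N G I-independent v∈I (J⊆I u∈J)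

  exchange : ∀ {T} → Independent G T → T ⊆ N G v → ∣ T ∣ ≤ suc ∣ J ∩ Nˢ G T ∣
  exchange {T} T-independent T⊆Nv = +-cancelˡ-≤ ∣ J ─ Nˢ G T ∣ _ _ (begin
    ∣ J ─ Nˢ G T ∣ + ∣ T ∣                ≤⟨ Disjoint⇒∣p∣+∣q∣≤∣p∪q∣ (J ─ Nˢ G T) T disjoint ⟩
    ∣ K ∣                                 ≤⟨ proj₂ maxI K K-independent ⟩
    ∣ I ∣                                 ≡⟨ ∣p∣≡∣p∩q∣+∣p─q∣ I ⁅ v ⁆ ⟩
    ∣ I ∩ ⁅ v ⁆ ∣ + ∣ J ∣                 ≤⟨ +-monoˡ-≤ ∣ J ∣ ∣I∩⁅v⁆∣≤1 ⟩
    1 + ∣ J ∣                             ≡⟨ cong suc (∣p∣≡∣p∩q∣+∣p─q∣ J (Nˢ G T)) ⟩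
    1 + (∣ J ∩ Nˢ G T ∣ + ∣ J ─ Nˢ G T ∣) ≡⟨ rearrange ∣ J ∩ Nˢ G T ∣ ∣ J ─ Nˢ G T ∣ ⟩
    ∣ J ─ Nˢ G T ∣ + suc ∣ J ∩ Nˢ G T ∣   ∎)
    where
    open ≤-Reasoning
    K : Subset n
    K = (J ─ Nˢ G T) ∪ T

    disjoint : ∀ {x} → x ∈ J ─ Nˢ G T → x ∉ T
    disjoint x∈ x∈T = J∩Nv≡∅ (proj₁ (x∈p─q⁻ J _ x∈)) (T⊆Nv x∈T)

    K-independent : Independent G K
    K-independent = Independent-∪ G (Independent-⊆ G (J⊆I ∘ proj₁ ∘ x∈p─q⁻ J _) I-independent)
                                    T-independent
                                    λ x∈ y∈T y∈Nx → proj₂ (x∈p─q⁻ J _ x∈) (∈⋃⁺ y∈T (N-sym G y∈Nx))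

    ∣I∩⁅v⁆∣≤1 : ∣ I ∩ ⁅ v ⁆ ∣ ≤ 1
    ∣I∩⁅v⁆∣≤1 = ≤-trans (∣p∩q∣≤∣q∣ I ⁅ v ⁆) (≤-reflexive (∣⁅x⁆∣≡1 v))

    rearrange : ∀ a b → 1 + (a + b) ≡ b + suc a
    rearrange = solve-∀

  InducedMatching⇒S : ∀ {d S} → Independent G S → S ⊆ N G v → InducedMatching G d S J →
                      InducedCopy G (SV d) (SAdj d)
  InducedMatching⇒S {d} {S} S-independent S⊆Nv M = embedding , injective , adjacency
    where
    embedding : SV d → Fin n
    embedding centre   = v
    embedding (mid i)  = left M i
    embedding (leaf i) = right M i

    left≢v : ∀ i → left M i ≢ v
    left≢v i eq = N-irrefl G (subst (_∈ N G v) eq (S⊆Nv (left∈ M i)))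

    right≢v : ∀ i → right M i ≢ v
    right≢v i eq = proj₂ (x∈p─q⁻ I ⁅ v ⁆ (right∈ M i)) (subst (_∈ ⁅ v ⁆) (sym eq) (x∈⁅x⁆ v))

    left≢right : ∀ i j → left M i ≢ right M j
    left≢right i j eq = J∩Nv≡∅ (right∈ M j) (subst (_∈ N G v) eq (S⊆Nv (left∈ M i)))

    injective : Injective _≡_ _≡_ embedding
    injective {centre} {centre} _  = refl
    injective {centre} {mid i}  eq = contradiction (sym eq) (left≢v i)
    injective {centre} {leaf i} eq = contradiction (sym eq) (right≢v i)
    injective {mid i}  {centre} eq = contradiction eq (left≢v i)
    injective {mid i}  {mid j}  eq = cong mid (left-injective G M eq)
    injective {mid i}  {leaf j} eq = contradiction eq (left≢right i j)
    injective {leaf i} {centre} eq = contradiction eq (right≢v i)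
    injective {leaf i} {mid j}  eq = contradiction (sym eq) (left≢right j i)
    injective {leaf i} {leaf j} eq = cong leaf (right-injective G M eq)

    adjacency : ∀ a b → adj G (embedding a) (embedding b) ≡ SAdj d a b
    adjacency centre   centre   = irrefl G v
    adjacency centre   (mid i)  = ∈-tabulate⁻ (S⊆Nv (left∈ M i))
    adjacency centre   (leaf i) = ∉N⇒adj≡false G (J∩Nv≡∅ (right∈ M i))
    adjacency (mid i)  centre   = ∈-tabulate⁻ (N-sym G (S⊆Nv (left∈ M i)))
    adjacency (mid i)  (mid j)  = S-independent _ _ (left∈ M i) (left∈ M j)
    adjacency (mid i)  (leaf j) with i ≟ j
    ... | yes refl = ∈-tabulate⁻ (matched M i)
    ... | no  i≢j  = ∉N⇒adj≡false G (unmatched M i≢j)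
    adjacency (leaf i) centre   = ∉N⇒adj≡false G (J∩Nv≡∅ (right∈ M i) ∘ N-sym G)
    adjacency (leaf i) (mid j)  with i ≟ j
    ... | yes refl = ∈-tabulate⁻ (N-sym G (matched M i))
    ... | no  i≢j  = ∉N⇒adj≡false G (unmatched M (i≢j ∘ sym) ∘ N-sym G)
    adjacency (leaf i) (leaf j) = I-independent _ _ (J⊆I (right∈ M i)) (J⊆I (right∈ M j))

  open-neighbourhood-bound : ∀ k m {S} → ¬ InducedCopy G (SV (suc k)) (SAdj (suc k)) →
                             ¬ InducedCopy G (Fin (suc m) ⊎ Fin (suc m)) (KAdj (suc m)) →
                             Independent G S → S ⊆ N G v →
                             ∣ S ∣ ≤ suc (heavyBound m k + k * pred (suc m ^ k))
  open-neighbourhood-bound k m {S} noS noK S-independent S⊆Nv = begin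
    ∣ S ∣                                       ≡⟨ ∣p∣≡∣p∩q∣+∣p─q∣ S H ⟩
    ∣ S ∩ H ∣ + ∣ T ∣                           ≤⟨ +-mono-≤ (≤-trans (∣p∩q∣≤∣q∣ S H) ∣H∣≤)
                                                            (exchange T-independent (S⊆Nv ∘ T⊆S)) ⟩
    heavyBound m k + suc ∣ J ∩ Nˢ G T ∣         ≤⟨ +-monoʳ-≤ (heavyBound m k) (s≤s ∣J∩NˢT∣≤) ⟩
    heavyBound m k + suc (k * pred (suc m ^ k)) ≡⟨ +-suc (heavyBound m k) _ ⟩
    suc (heavyBound m k + k * pred (suc m ^ k)) ∎
    where
    open ≤-Reasoning
    H T : Subset n
    H = heavy G (suc m ^ k) S J
    T = S ─ H

    T⊆S : T ⊆ S
    T⊆S = p─q⊆p S H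

    T-independent : Independent G T
    T-independent = Independent-⊆ G T⊆S S-independent

    noMatching : ¬ InducedMatching G (suc k) S J
    noMatching = noS ∘ InducedMatching⇒S S-independent S⊆Nv

    ∣H∣≤ : ∣ H ∣ ≤ heavyBound m k
    ∣H∣≤ = heavy-bound G m k (¬K⇒BicliqueFree G noK S-independent (Independent-⊆ G J⊆I I-independent))
                             noMatching

    ∣J∩NˢT∣≤ : ∣ J ∩ Nˢ G T ∣ ≤ k * pred (suc m ^ k)
    ∣J∩NˢT∣≤ = ∣B∩NˢA∣≤k*c G (noMatching ∘ InducedMatching-monoˡ G T⊆S) λ z∈T →
      let z∈S , z∉H = x∈p─q⁻ S H z∈T in <⇒≤pred (≰⇒> (z∉H ∘ heavy⁺ G z∈S))

  closed-neighbourhood-bound : ∀ {c} → (∀ {S} → Independent G S → S ⊆ N G v → ∣ S ∣ ≤ suc c) →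
                               ∀ S → Independent G S → (∀ u → u ∈ S → InClosedNbhd G v u) → ∣ S ∣ ≤ suc c
  closed-neighbourhood-bound open-bound S S-independent S⊆N[v] with v ∈? S
  ... | yes v∈S = ≤-trans (p⊆q⇒∣p∣≤∣q∣ S⊆⁅v⁆) (≤-trans (≤-reflexive (∣⁅x⁆∣≡1 v)) (s≤s z≤n))
    where
    S⊆⁅v⁆ : S ⊆ ⁅ v ⁆
    S⊆⁅v⁆ {u} u∈S with S⊆N[v] u u∈S
    ... | inj₁ refl = x∈⁅x⁆ v
    ... | inj₂ v~u  = contradiction (∈-tabulate⁺ v~u) (Independent⇒∉N G S-independent v∈S u∈S)
  ... | no  v∉S = open-bound S-independent S⊆Nv
    where
    S⊆Nv : S ⊆ N G v
    S⊆Nv {u} u∈S with S⊆N[v] u u∈S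
    ... | inj₁ refl = contradiction u∈S v∉S
    ... | inj₂ v~u  = ∈-tabulate⁺ v~u

-- Arithmetic

heavyBound+2≤2*l^k : ∀ m k → heavyBound m k + 2 ≤ 2 * suc m ^ k
heavyBound+2≤2*l^k m zero          = ≤-refl
heavyBound+2≤2*l^k m (suc zero)    = ≤-trans (m≤m+n (m + 2) m) (≤-reflexive (identity m))
  where
  identity : ∀ m → m + 2 + m ≡ 2 * (suc m * 1)
  identity = solve-∀
heavyBound+2≤2*l^k m (suc (suc k)) = begin
  suc m * h + 2 * m + 2 ≡⟨ factor m h ⟩
  suc m * (h + 2)       ≤⟨ *-monoʳ-≤ (suc m) (heavyBound+2≤2*l^k m (suc k)) ⟩
  suc m * (2 * P)       ≡⟨ swap m P ⟩
  2 * (suc m * P)       ∎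
  where
  open ≤-Reasoning
  h P : ℕ
  h = heavyBound m (suc k)
  P = suc m ^ suc k
  factor : ∀ m h → suc m * h + 2 * m + 2 ≡ suc m * (h + 2)
  factor = solve-∀
  swap : ∀ m P → suc m * (2 * P) ≡ 2 * (suc m * P)
  swap = solve-∀

count<bound : ∀ k m →
  suc (heavyBound m k + k * pred (suc m ^ k)) < suc k ^ 2 * suc m + 2 * suc k * suc m ^ k
count<bound k m = begin
  suc (suc (h + k * pred P))        ≡⟨ shift h (k * pred P) ⟩
  h + 2 + k * pred P                ≤⟨ +-monoʳ-≤ (h + 2) (*-monoʳ-≤ k pred[n]≤n) ⟩
  h + 2 + k * P                     ≤⟨ +-monoˡ-≤ (k * P) (heavyBound+2≤2*l^k m k) ⟩
  2 * P + k * P                     ≤⟨ m≤m+n (2 * P + k * P) (k * P) ⟩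
  2 * P + k * P + k * P             ≡⟨ collect k P ⟩
  2 * suc k * P                     ≤⟨ m≤n+m (2 * suc k * P) (suc k ^ 2 * suc m) ⟩
  suc k ^ 2 * suc m + 2 * suc k * P ∎
  where
  open ≤-Reasoning
  h P : ℕ
  h = heavyBound m k
  P = suc m ^ k
  shift : ∀ h a → suc (suc (h + a)) ≡ h + 2 + a
  shift = solve-∀
  collect : ∀ k P → 2 * P + k * P + k * P ≡ 2 * suc k * P
  collect = solve-∀

count<2l : ∀ m → suc (heavyBound m 1 + 1 * pred (suc m ^ 1)) < 2 * suc m
count<2l m = ≤-reflexive (identity m)
  where
  identity : ∀ m → suc (suc (m + 1 * (m * 1))) ≡ 2 * suc m
  identity = solve-∀

theorem3p4 : (d l : ℕ) → 2 ≤ d → 2 ≤ l → {n : ℕ} → (G : Graph n) → SKFree d l G →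
    (I : Subset n) → MaximumIndependent G I →
    (∀ v → v ∈ I → AlphaClosedNbhd< G v (d ^ 2 * l + 2 * d * l ^ (d ∸ 1)))
    × (d ≡ 2 → ∀ v → v ∈ I → AlphaClosedNbhd< G v (2 * l))
theorem3p4 (suc k) (suc m) (s≤s _) (s≤s _) G (noS , noK) I maxI =
  (λ v v∈I → α< v v∈I (count<bound k m)) , λ { refl v v∈I → α< v v∈I (count<2l m) }
  where
  α< : ∀ {b} v → v ∈ I → suc (heavyBound m k + k * pred (suc m ^ k)) < b → AlphaClosedNbhd< G v b
  α< v v∈I count<b S S-independent S⊆N[v] = ≤-<-trans ∣S∣≤count count<b
    where
    ∣S∣≤count : ∣ S ∣ ≤ suc (heavyBound m k + k * pred (suc m ^ k))
    ∣S∣≤count = closed-neighbourhood-bound G maxI v∈I (open-neighbourhood-bound G maxI v∈I k m noS noK)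
                                           S S-independent S⊆N[v]
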